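{- Let $\gamma_1,\dots,\gamma_m/\varphi$ be a rule such that there is a derivation in $\mathsf{R}'_{\mathrm{BK}}$ witnessing $\gamma_1,\dots,\gamma_m\vdash_{\mathsf{R}'_{\mathrm{BK}}}\varphi$ that uses no instance of rule (1$\star$) $p,\neg p/q$. Then for every variable $s$ not occurring in $\gamma_1,\dots,\gamma_m,\varphi$: $s\lor\gamma_1,\dots,s\lor\gamma_m\vdash_{\mathsf{R}'_{\mathrm{BK}}}s\lor\varphi$ and $s\to\gamma_1,\dots,s\to\gamma_m\vdash_{\mathsf{R}'_{\mathrm{BK}}}s\to\varphi$, where $\alpha\to\beta$ abbreviates $\neg\alpha\lor\beta$.
   Context: Formulas are built from a countably infinite set of variables with binary $\land,\lor$ and unary $\neg$. Set-Fmla Hilbert systems: rule schemas $\gamma_1,\dots,\gamma_m/\varphi$ with all substitution instances; $\Gamma\vdash_{\mathsf R}\varphi$ iff some finite sequence (a derivation) ending in $\varphi$ has each member in $\Gamma$ or the conclusion of a rule instance whose premises occur earlier. The $\lor$-lifted version of a rule $\gamma_1,\dots,\gamma_m/\varphi$ is $s\lor\gamma_1,\dots,s\lor\gamma_m/s\lor\varphi$ with $s$ a variable not occurring in the rule. $\mathsf{R}'_{\mathrm{BK}}$ has rule schemas ($p,q,r$ distinct): (1$\star$) $p,\neg p/q$; (2) $p/\neg\neg p$; (3) $\neg\neg p/p$; (4) $p,q/p\land q$; (5) $\neg p,\neg q/\neg(p\land q)$; (6) $\neg p,q/\neg(p\land q)$; (7) $p,\neg q/\neg(p\land q)$; (8$\star$)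 $\neg(p\land q)/\neg p\lor p$; (9$\star$) $\neg(p\land q)/\neg q\lor q$; (10) $p\land q/p$; (11) $p\land q/q$; (12) $\neg p,\neg q/\neg(p\lor q)$; (13) $\neg(p\lor q)/\neg p$; (14) $\neg(p\lor q)/\neg q$; (15$\star$) $p\lor q/p\lor\neg p$; (16$\star$) $p\lor q/q\lor\neg q$; (17) $\neg p,q/p\lor q$; (18) $p,\neg q/p\lor q$; (19) $p,q/p\lor q$; (20) $p\lor q,\neg p/q$; (21) $p\lor(q\lor r)/(p\lor q)\lor r$; (22) $p\lor p/p$; (23) $p\lor q/q\lor p$; (24) $p\lor q,r/\neg p\lor r$; plus the $\lor$-lifted versions of all these except (1$\star$). -}

module Defs where

open import Data.Nat using (ℕ)
open import Data.List using (List; []; _∷_; map)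
open import Data.List.Membership.Propositional using (_∈_)
open import Data.List.Relation.Unary.All using (All)
open import Data.List.Relation.Unary.Any using (Any)
open import Data.Product using (Σ; _×_)
open import Relation.Binary.PropositionalEquality using (_≡_)

infixr 8 _∧'_
infixr 7 _∨'_
infix 9 ~_
data Fmla : Set where
  var  : ℕ → Fmla
  _∧'_ : Fmla → Fmla → Fmla
  _∨'_ : Fmla → Fmla → Fmla
  ~_   : Fmla → Fmla

_⇒'_ : Fmla → Fmla → Fmla
α ⇒' β = ~ α ∨' β

data _occursIn_ (s : ℕ) : Fmla → Set where
  here  : s occursIn var s
  ∧ˡ : ∀ {a b} → s occursIn a → s occursIn (a ∧' b)
  ∧ʳ : ∀ {a b} → s occursIn b → s occursIn (a ∧' b)
  ∨ˡ : ∀ {a b} → s occursIn a → s occursIn (a ∨' b)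
  ∨ʳ : ∀ {a b} → s occursIn b → s occursIn (a ∨' b)
  ~o : ∀ {a} → s occursIn a → s occursIn (~ a)

data Basic : List Fmla → Fmla → Set where
  r2  : ∀ p → Basic (p ∷ []) (~ ~ p)
  r3  : ∀ p → Basic (~ ~ p ∷ []) p
  r4  : ∀ p q → Basic (p ∷ q ∷ []) (p ∧' q)
  r5  : ∀ p q → Basic (~ p ∷ ~ q ∷ []) (~ (p ∧' q))
  r6  : ∀ p q → Basic (~ p ∷ q ∷ []) (~ (p ∧' q))
  r7  : ∀ p q → Basic (p ∷ ~ q ∷ []) (~ (p ∧' q))
  r8  : ∀ p q → Basic (~ (p ∧' q) ∷ []) (~ p ∨' p)
  r9  : ∀ p q → Basic (~ (p ∧' q) ∷ []) (~ q ∨' q)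
  r10 : ∀ p q → Basic (p ∧' q ∷ []) p
  r11 : ∀ p q → Basic (p ∧' q ∷ []) q
  r12 : ∀ p q → Basic (~ p ∷ ~ q ∷ []) (~ (p ∨' q))
  r13 : ∀ p q → Basic (~ (p ∨' q) ∷ []) (~ p)
  r14 : ∀ p q → Basic (~ (p ∨' q) ∷ []) (~ q)
  r15 : ∀ p q → Basic (p ∨' q ∷ []) (p ∨' ~ p)
  r16 : ∀ p q → Basic (p ∨' q ∷ []) (q ∨' ~ q)
  r17 : ∀ p q → Basic (~ p ∷ q ∷ []) (p ∨' q)
  r18 : ∀ p q → Basic (p ∷ ~ q ∷ []) (p ∨' q)
  r19 : ∀ p q → Basic (p ∷ q ∷ []) (p ∨' q)
  r20 : ∀ p q → Basic (p ∨' q ∷ ~ p ∷ []) q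
  r21 : ∀ p q r → Basic (p ∨' (q ∨' r) ∷ []) (((p ∨' q) ∨' r))
  r22 : ∀ p → Basic (p ∨' p ∷ []) p
  r23 : ∀ p q → Basic (p ∨' q ∷ []) (q ∨' p)
  r24 : ∀ p q r → Basic (p ∨' q ∷ r ∷ []) (~ p ∨' r)

-- Instances of all rules of R'_BK other than (1⋆): rules (2)–(24) and the
-- ∨-lifted versions of (2)–(24) (the fresh variable s of the lifted schema
-- may be instantiated by any formula δ).
data InstNo1 : List Fmla → Fmla → Set where
  basic : ∀ {ps φ} → Basic ps φ → InstNo1 ps φ
  lift  : ∀ {ps φ} (δ : Fmla) → Basic ps φ → InstNo1 (map (δ ∨'_) ps) (δ ∨' φ)

data Inst : List Fmla → Fmla → Set where
  r1    : ∀ p q → Inst (p ∷ ~ p ∷ []) q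
  other : ∀ {ps φ} → InstNo1 ps φ → Inst ps φ

-- Derivations (finite sequences) from hypotheses Γ using rule instances R.
-- 'Deriv R Γ xs' : xs is a justified sequence, stored latest-first.
data Deriv (R : List Fmla → Fmla → Set) (Γ : List Fmla) : List Fmla → Set where
  []    : Deriv R Γ []
  hyp   : ∀ {xs φ} → φ ∈ Γ → Deriv R Γ xs → Deriv R Γ (φ ∷ xs)
  rule  : ∀ {xs φ} ps → R ps φ → All (_∈ xs) ps → Deriv R Γ xs → Deriv R Γ (φ ∷ xs)

_⊢[_]_ : List Fmla → (List Fmla → Fmla → Set) → Fmla → Set
Γ ⊢[ R ] φ = Σ (List Fmla) (λ xs → Deriv R Γ (φ ∷ xs))

_⊢BK_ : List Fmla → Fmla → Set
Γ ⊢BK φ = Γ ⊢[ Inst ] φ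

_⊢BK-no1_ : List Fmla → Fmla → Set
Γ ⊢BK-no1 φ = Γ ⊢[ InstNo1 ] φ

-- The lifted rules of R'_BK are stated for an arbitrary disjunct, so a
-- (1⋆)-free derivation lifts line by line: hypotheses γ become δ ∨ γ, an
-- instance of a basic rule becomes its ∨-lifted instance, and an instance of a
-- lifted rule with disjunct δ' becomes the lifted instance with disjunct
-- δ ∨ δ', wrapped in reassociations by (21) and commutations by (23).
module Submission where

open import Defs
open import Data.Nat using (ℕ)
open import Data.List using (List; map; []; _∷_; _++_)
open import Data.List.Relation.Unary.Any using (Any; here)
open import Data.List.Relation.Unary.All using (All; []; _∷_; lookup)
import Data.List.Relation.Unary.All as All
open import Data.List.Relation.Unary.All.Properties using (map⁺; map⁻)
open import Data.List.Membership.Propositional using (_∈_)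
open import Data.List.Membership.Propositional.Properties using (∈-++⁺ˡ; ∈-++⁺ʳ; ∈-map⁺)
open import Data.Product using (_×_; Σ; _,_)
open import Relation.Nullary using (¬_)
open import Relation.Binary.PropositionalEquality using (refl)

module _ {R : List Fmla → Fmla → Set} {Γ : List Fmla} where

  Deriv-++ : ∀ {xs ys} → Deriv R Γ xs → Deriv R Γ ys → Deriv R Γ (xs ++ ys)
  Deriv-++ []              e = e
  Deriv-++ (hyp m d)       e = hyp m (Deriv-++ d e)
  Deriv-++ (rule ps r m d) e = rule ps r (All.map ∈-++⁺ˡ m) (Deriv-++ d e)

  Deriv-merge : ∀ ps → All (Γ ⊢[ R ]_) ps →
                Σ (List Fmla) λ zs → Deriv R Γ zs × All (_∈ zs) ps
  Deriv-merge []       []              = [] , [] , []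
  Deriv-merge (p ∷ ps) ((xs , d) ∷ ds) with Deriv-merge ps ds
  ... | zs , e , m = (p ∷ xs) ++ zs , Deriv-++ d e , here refl ∷ All.map (∈-++⁺ʳ (p ∷ xs)) m

  ⊢-rule : ∀ {ps φ} → R ps φ → All (Γ ⊢[ R ]_) ps → Γ ⊢[ R ] φ
  ⊢-rule {ps} r ds with Deriv-merge ps ds
  ... | zs , e , m = zs , rule ps r m e

module _ {Γ : List Fmla} where

  ⊢BK-basic : ∀ {ps φ} → Basic ps φ → All (Γ ⊢BK_) ps → Γ ⊢BK φ
  ⊢BK-basic b = ⊢-rule (other (basic b))

  ⊢BK-lift : ∀ {ps φ} δ → Basic ps φ → All (Γ ⊢BK_) (map (δ ∨'_) ps) → Γ ⊢BK (δ ∨' φ)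
  ⊢BK-lift δ b = ⊢-rule (other (lift δ b))

  ⊢BK-∨-assocˡ : ∀ a b c → Γ ⊢BK (a ∨' (b ∨' c)) → Γ ⊢BK ((a ∨' b) ∨' c)
  ⊢BK-∨-assocˡ a b c d = ⊢BK-basic (r21 a b c) (d ∷ [])

  ⊢BK-∨-comm : ∀ a b → Γ ⊢BK (a ∨' b) → Γ ⊢BK (b ∨' a)
  ⊢BK-∨-comm a b d = ⊢BK-basic (r23 a b) (d ∷ [])

  ⊢BK-∨-commʳ : ∀ a b c → Γ ⊢BK (a ∨' (b ∨' c)) → Γ ⊢BK (a ∨' (c ∨' b))
  ⊢BK-∨-commʳ a b c d = ⊢BK-lift a (r23 b c) (d ∷ [])

  -- (21) only reassociates to the left; the other direction goes round via (23):
  -- (a∨b)∨c ⊢ c∨(a∨b) ⊢ c∨(b∨a) ⊢ (c∨b)∨a ⊢ a∨(c∨b) ⊢ a∨(b∨c).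
  ⊢BK-∨-assocʳ : ∀ a b c → Γ ⊢BK ((a ∨' b) ∨' c) → Γ ⊢BK (a ∨' (b ∨' c))
  ⊢BK-∨-assocʳ a b c d =
    ⊢BK-∨-commʳ a c b
      (⊢BK-∨-comm (c ∨' b) a
        (⊢BK-∨-assocˡ c b a
          (⊢BK-∨-commʳ c a b
            (⊢BK-∨-comm (a ∨' b) c d))))

Deriv-lift : ∀ {Γ xs} δ → Deriv InstNo1 Γ xs → All (λ x → map (δ ∨'_) Γ ⊢BK (δ ∨' x)) xs
Deriv-lift δ [] = []
Deriv-lift δ (hyp m d) = ([] , hyp (∈-map⁺ (δ ∨'_) m) []) ∷ Deriv-lift δ d
Deriv-lift δ (rule ps (basic b) m d) =
  ⊢BK-lift δ b (map⁺ (All.map (lookup ih) m)) ∷ ih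
  where ih = Deriv-lift δ d
Deriv-lift δ (rule _ (lift {ps} δ' b) m d) =
  ⊢BK-∨-assocʳ δ δ' _ (⊢BK-lift (δ ∨' δ') b (map⁺ premises)) ∷ ih
  where
    ih = Deriv-lift δ d
    premises : All (λ p → _ ⊢BK ((δ ∨' δ') ∨' p)) ps
    premises = All.map (λ x → ⊢BK-∨-assocˡ δ δ' _ (lookup ih x)) (map⁻ m)

⊢BK-no1-lift : ∀ {Γ φ} δ → Γ ⊢BK-no1 φ → map (δ ∨'_) Γ ⊢BK (δ ∨' φ)
⊢BK-no1-lift δ (_ , d) with Deriv-lift δ d
... | lifted ∷ _ = lifted

corollary2 : (γs : List Fmla) (φ : Fmla) → γs ⊢BK-no1 φ →
    (s : ℕ) → ¬ Any (s occursIn_) γs → ¬ (s occursIn φ) →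
    (map (var s ∨'_) γs ⊢BK (var s ∨' φ))
      × (map (var s ⇒'_) γs ⊢BK (var s ⇒' φ))
corollary2 γs φ d s _ _ = ⊢BK-no1-lift (var s) d , ⊢BK-no1-lift (~ var s) d
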